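{- For $i\in\mathbb N=\{0,1,2,\dots\}$ and a function $f:X\to Y$ between finite sets, let $\gamma_i(f)=\#\{y\in Y\mid\#f^{ -1}(y)\ge i\}$. For $i\in\mathbb N\setminus\{0,1\}$, each $\gamma_i$ induces a well-defined additive monotone $G_i:[f]\mapsto\gamma_i(f)$ on the ordered monoid $(\lvert\mathrm{PCD}(\mathbf{Set},\mathbf{Inj})\rvert,\succeq,\sqcup)$, i.e. $G_i$ is order-preserving into $(\mathbb R,\ge)$ and a monoid homomorphism into $(\mathbb R,+)$; and the family $\{G_i\}_{i\in\mathbb N\setminus\{0,1\}}$ is complete: for all functions $f,g$ between finite sets, $f\succeq g$ if and only if $\gamma_i(f)\ge\gamma_i(g)$ for all $i\ge 2$.
   Context: $\mathbf{Set}$ is the symmetric monoidal category of finite sets and functions with monoidal product disjoint union $\sqcup$; $\mathbf{Inj}$ is its subcategory of all finite sets and injective functions. For functions $f,g$ between finite sets, $f\succeq g$ means there exist a finite set $Z$, injective functions $\xi_1,\xi_2$ and a function $j$ between finite sets with $\xi_2\circ(f\sqcup 1_Z)\circ\xi_1=g\sqcup j$. This is a preorder compatible with $\sqcup$; $(\lvert\mathrm{PCD}(\mathbf{Set},\mathbf{Inj})\rvert,\succeq,\sqcup)$ is the commutative ordered monoid of equivalence classes $[f]$ under mutual $\succeq$, with $[f]\sqcup[g]=[f\sqcup g]$ and unit the class of identity functions. $\#S$ denotes cardinality. -}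

module Defs where

open import Data.Nat using (ℕ; _+_; _≤?_)
open import Data.Fin using (Fin; splitAt; join; _≟_)
open import Data.Sum using (map)
open import Data.List using (List; length; filter; allFin)
open import Data.Product using (Σ; _×_)
open import Function using (_∘_)
open import Function.Definitions using (Injective)
open import Relation.Binary.PropositionalEquality using (_≡_)

_⊔_ : ∀ {a b c d} → (Fin a → Fin b) → (Fin c → Fin d) → Fin (a + c) → Fin (b + d)
_⊔_ {a} {b} {c} {d} f g = join b d ∘ map f g ∘ splitAt a

idF : ∀ z → Fin z → Fin z
idF z x = x

fiberSize : ∀ {m n} → (Fin m → Fin n) → Fin n → ℕ
fiberSize {m} f y = length (filter (λ x → f x ≟ y) (allFin m))

γ : ∀ {m n} → ℕ → (Fin m → Fin n) → ℕ
γ {m} {n} i f = length (filter (λ y → i ≤? fiberSize f y) (allFin n))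

_≽_ : ∀ {m n p q} → (Fin m → Fin n) → (Fin p → Fin q) → Set
_≽_ {m} {n} {p} {q} f g =
  Σ ℕ λ z → Σ ℕ λ r → Σ ℕ λ s →
  Σ (Fin r → Fin s) λ j →
  Σ (Fin (p + r) → Fin (m + z)) λ ξ₁ →
  Σ (Fin (n + z) → Fin (q + s)) λ ξ₂ →
  Injective _≡_ _≡_ ξ₁ × Injective _≡_ _≡_ ξ₂ ×
  (∀ x → ξ₂ ((f ⊔ idF z) (ξ₁ x)) ≡ (g ⊔ j) x)

module Submission where

-- Only the multiset of fiber sizes matters. Disjoint union concatenates these multisets, an
-- identity contributes only singletons, and composing with injections can only shrink fibers,
-- so each γ i with i ≥ 2 is additive, kills identities and is monotone. Conversely, if
-- γ i f ≥ γ i g for all i ≥ 2, a greedy argument matches the fibers of g of size at least 2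
-- injectively with fibers of f that are at least as large; embedding each of them into its
-- partner, and the singleton fibers of g into a copy of the identity on the codomain of g,
-- exhibits g inside f ⊔ 1_Z along injections.

open import Defs
open import Data.Nat using (ℕ; zero; suc; _≤_; _≥_; _+_; z≤n; s≤s; _≤?_)
open import Data.Nat.Properties
  using (≤-refl; ≤-trans; ≰⇒>; ≤-antisym; ≤-pred; +-identityʳ; m≤m+n; module ≤-Reasoning)
open import Data.Fin
  using (Fin; zero; suc; _≟_; _↑ˡ_; _↑ʳ_; splitAt; punchIn; punchOut; fromℕ<; inject≤)
open import Data.Fin.Properties
  using ( suc-injective; punchIn-injective; punchInᵢ≢i; punchIn-punchOut; punchOut-injective
        ; ↑ˡ-injective; ↑ʳ-injective; splitAt-↑ˡ; splitAt-↑ʳ; splitAt⁻¹-↑ˡ; any?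
        ; injective⇒≤; inject≤-injective)
open import Data.List using (length; filter; tabulate; allFin)
open import Data.List.Extrema.Nat using (argmax; f[xs]≤f[argmax])
open import Data.List.Relation.Unary.All as All using ()
open import Data.List.Membership.Propositional.Properties using (∈-allFin)
open import Data.Product using (Σ; ∃; _×_; _,_; proj₁; proj₂)
open import Data.Sum using (inj₁; [_,_]′)
open import Data.Empty using (⊥-elim)
open import Function using (_∘_; id)
open import Function.Bundles using (_⇔_; mk⇔)
open import Function.Definitions using (Injective)
open import Relation.Nullary using (Dec; yes; no; ¬_)
open import Relation.Unary using (Decidable)
open import Relation.Binary.PropositionalEquality

count : ∀ {n} {P : Fin n → Set} → Decidable P → ℕ
count {zero}  P? = 0
count {suc n} P? with P? zero
... | yes _ = suc (count (λ x → P? (suc x)))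
... | no  _ = count (λ x → P? (suc x))

enumerate : ∀ {n} {P : Fin n → Set} (P? : Decidable P) → Fin (count P?) → Fin n
enumerate {suc n} P? k with P? zero
enumerate {suc n} P? zero    | yes _ = zero
enumerate {suc n} P? (suc k) | yes _ = suc (enumerate (λ x → P? (suc x)) k)
enumerate {suc n} P? k       | no  _ = suc (enumerate (λ x → P? (suc x)) k)

enumerate-satisfies : ∀ {n} {P : Fin n → Set} (P? : Decidable P) k → P (enumerate P? k)
enumerate-satisfies {suc n} P? k with P? zero
enumerate-satisfies {suc n} P? zero    | yes p = p
enumerate-satisfies {suc n} P? (suc k) | yes _ = enumerate-satisfies (λ x → P? (suc x)) k
enumerate-satisfies {suc n} P? k       | no  _ = enumerate-satisfies (λ x → P? (suc x)) k

enumerate-injective : ∀ {n} {P : Fin n → Set} (P? : Decidable P) →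
  Injective _≡_ _≡_ (enumerate P?)
enumerate-injective {suc n} P? {k} {l} eq with P? zero
enumerate-injective {suc n} P? {zero}  {zero}  eq | yes _ = refl
enumerate-injective {suc n} P? {suc k} {suc l} eq | yes _ =
  cong suc (enumerate-injective (λ x → P? (suc x)) (suc-injective eq))
enumerate-injective {suc n} P? {k}     {l}     eq | no  _ =
  enumerate-injective (λ x → P? (suc x)) (suc-injective eq)

position : ∀ {n} {P : Fin n → Set} (P? : Decidable P) {x} → P x → Fin (count P?)
position {suc n} P? {x} px with P? zero
position {suc n} P? {zero}  px | yes _  = zero
position {suc n} P? {suc x} px | yes _  = suc (position (λ x → P? (suc x)) px)
position {suc n} P? {zero}  px | no  ¬p = ⊥-elim (¬p px)
position {suc n} P? {suc x} px | no  _  = position (λ x → P? (suc x)) px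

enumerate-position : ∀ {n} {P : Fin n → Set} (P? : Decidable P) {x} (px : P x) →
  enumerate P? (position P? px) ≡ x
enumerate-position {suc n} P? {x} px with P? zero
enumerate-position {suc n} P? {zero}  px | yes _  = refl
enumerate-position {suc n} P? {suc x} px | yes _  = cong suc (enumerate-position (λ x → P? (suc x)) px)
enumerate-position {suc n} P? {zero}  px | no  ¬p = ⊥-elim (¬p px)
enumerate-position {suc n} P? {suc x} px | no  _  = cong suc (enumerate-position (λ x → P? (suc x)) px)

position-injective : ∀ {n} {P : Fin n → Set} (P? : Decidable P) {x y} (px : P x) (py : P y) →
  position P? px ≡ position P? py → x ≡ y
position-injective P? px py eq =
  trans (sym (enumerate-position P? px)) (trans (cong (enumerate P?) eq) (enumerate-position P? py))

record Matching {p m} (P : Fin p → Set) (R : Fin p → Fin m → Set) : Set where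
  field
    partner    : ∀ x → P x → Fin m
    related    : ∀ x (px : P x) → R x (partner x px)
    injective  : ∀ {x y} (px : P x) (py : P y) → partner x px ≡ partner y py → x ≡ y

open Matching

Matching-∅ : ∀ {p m} {P : Fin p → Set} {R : Fin p → Fin m → Set} → (∀ x → ¬ P x) → Matching P R
Matching-∅ ∅ = record
  { partner = λ x px → ⊥-elim (∅ x px)
  ; related = λ x px → ⊥-elim (∅ x px)
  ; injective = λ px _ _ → ⊥-elim (∅ _ px)
  }

Matching-punchIn : ∀ {p m} {P : Fin (suc p) → Set} {R : Fin (suc p) → Fin (suc m) → Set}
  (x₀ : Fin (suc p)) (w₀ : Fin (suc m)) → R x₀ w₀ →
  Matching (λ x → P (punchIn x₀ x)) (λ x u → R (punchIn x₀ x) (punchIn w₀ u)) → Matching P R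
Matching-punchIn {m = m} {P} {R} x₀ w₀ r₀ M = record
  { partner   = λ x → partner′ x (x₀ ≟ x)
  ; related   = λ x → related′ x (x₀ ≟ x)
  ; injective = λ {x} {y} → injective′ x y (x₀ ≟ x) (x₀ ≟ y)
  }
  where
  P-punchOut : ∀ {x} (x₀≢x : x₀ ≢ x) → P x → P (punchIn x₀ (punchOut x₀≢x))
  P-punchOut x₀≢x = subst P (sym (punchIn-punchOut x₀≢x))

  partner′ : ∀ x → Dec (x₀ ≡ x) → P x → Fin (suc m)
  partner′ x (yes _)     _  = w₀
  partner′ x (no x₀≢x) px = punchIn w₀ (partner M (punchOut x₀≢x) (P-punchOut x₀≢x px))

  related′ : ∀ x (d : Dec (x₀ ≡ x)) (px : P x) → R x (partner′ x d px)
  related′ x (yes refl) _  = r₀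
  related′ x (no x₀≢x) px = subst (λ x′ → R x′ (partner′ x (no x₀≢x) px)) (punchIn-punchOut x₀≢x)
    (related M (punchOut x₀≢x) (P-punchOut x₀≢x px))

  injective′ : ∀ x y (d : Dec (x₀ ≡ x)) (d′ : Dec (x₀ ≡ y)) (px : P x) (py : P y) →
    partner′ x d px ≡ partner′ y d′ py → x ≡ y
  injective′ x y (yes x₀≡x) (yes x₀≡y) _ _ _  = trans (sym x₀≡x) x₀≡y
  injective′ x y (yes _)    (no _)     _ _ eq = ⊥-elim (punchInᵢ≢i w₀ _ (sym eq))
  injective′ x y (no _)     (yes _)    _ _ eq = ⊥-elim (punchInᵢ≢i w₀ _ eq)
  injective′ x y (no x₀≢x)  (no x₀≢y)  _ _ eq =
    punchOut-injective x₀≢x x₀≢y (injective M _ _ (punchIn-injective w₀ _ _ eq))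

matching⇒count≤ : ∀ {p m} {P : Fin p → Set} {Q : Fin m → Set} (P? : Decidable P) (Q? : Decidable Q) →
  Matching P (λ _ → Q) → count P? ≤ count Q?
matching⇒count≤ P? Q? M = injective⇒≤ {f = f} f-injective
  where
  f : Fin (count P?) → Fin (count Q?)
  f k = position Q? (related M _ (enumerate-satisfies P? k))
  f-injective : Injective _≡_ _≡_ f
  f-injective eq = enumerate-injective P?
    (injective M _ _ (position-injective Q? _ _ eq))

count≤⇒matching : ∀ {p m} {P : Fin p → Set} {Q : Fin m → Set} (P? : Decidable P) (Q? : Decidable Q) →
  count P? ≤ count Q? → Matching P (λ _ → Q)
count≤⇒matching P? Q? le = record
  { partner   = λ _ px → enumerate Q? (inject≤ (position P? px) le)
  ; related   = λ _ px → enumerate-satisfies Q? _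
  ; injective = λ px py eq → position-injective P? px py
      (inject≤-injective le le _ _ (enumerate-injective Q? eq))
  }

count-mono : ∀ {n} {P Q : Fin n → Set} (P? : Decidable P) (Q? : Decidable Q) →
  (∀ x → P x → Q x) → count P? ≤ count Q?
count-mono P? Q? P⊆Q = matching⇒count≤ P? Q? record
  { partner = λ x _ → x ; related = P⊆Q ; injective = λ _ _ eq → eq }

count-cong : ∀ {n} {P Q : Fin n → Set} (P? : Decidable P) (Q? : Decidable Q) →
  (∀ x → P x → Q x) → (∀ x → Q x → P x) → count P? ≡ count Q?
count-cong P? Q? P⊆Q Q⊆P = ≤-antisym (count-mono P? Q? P⊆Q) (count-mono Q? P? Q⊆P)

count-none : ∀ {n} {P : Fin n → Set} (P? : Decidable P) → (∀ x → ¬ P x) → count P? ≡ 0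
count-none {zero}  P? ∅ = refl
count-none {suc n} P? ∅ with P? zero
... | yes p = ⊥-elim (∅ zero p)
... | no  _ = count-none (λ x → P? (suc x)) (∅ ∘ suc)

count-witness : ∀ {n} {P : Fin n → Set} (P? : Decidable P) → 1 ≤ count P? → ∃ P
count-witness P? 0<count = enumerate P? (fromℕ< 0<count) , enumerate-satisfies P? _

count-punchIn : ∀ {n} {P : Fin (suc n) → Set} (P? : Decidable P) y → P y →
  count P? ≡ suc (count (λ x → P? (punchIn y x)))
count-punchIn P? zero py with P? zero
... | yes _  = refl
... | no  ¬p = ⊥-elim (¬p py)
count-punchIn {suc n} P? (suc y) py with P? zero
... | yes _ = cong suc (count-punchIn (λ x → P? (suc x)) y py)
... | no  _ = count-punchIn (λ x → P? (suc x)) y py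

count-split : ∀ a c {P : Fin (a + c) → Set} (P? : Decidable P) →
  count P? ≡ count (λ x → P? (x ↑ˡ c)) + count (λ x → P? (a ↑ʳ x))
count-split zero    c P? = refl
count-split (suc a) c P? with P? zero
... | yes _ = cong suc (count-split a c (λ x → P? (suc x)))
... | no  _ = count-split a c (λ x → P? (suc x))

filter-tabulate-count : ∀ {A : Set} {n} {P : A → Set} (P? : Decidable P) (h : Fin n → A) →
  length (filter P? (tabulate h)) ≡ count (λ x → P? (h x))
filter-tabulate-count {n = zero}  P? h = refl
filter-tabulate-count {n = suc n} P? h with P? (h zero)
... | yes _ = cong suc (filter-tabulate-count P? (h ∘ suc))
... | no  _ = filter-tabulate-count P? (h ∘ suc)

countAtLeast : ∀ {n} → (Fin n → ℕ) → ℕ → ℕ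
countAtLeast a i = count (λ y → i ≤? a y)

countAtLeast-cong : ∀ {n} {a b : Fin n → ℕ} → (∀ y → a y ≡ b y) → ∀ i → countAtLeast a i ≡ countAtLeast b i
countAtLeast-cong a≗b i = count-cong _ _
  (λ y → subst (i ≤_) (a≗b y)) (λ y → subst (i ≤_) (sym (a≗b y)))

fiberSize-count : ∀ {m n} (f : Fin m → Fin n) y → fiberSize f y ≡ count (λ x → f x ≟ y)
fiberSize-count f y = filter-tabulate-count (λ x → f x ≟ y) id

γ-countAtLeast : ∀ {m n} i (f : Fin m → Fin n) → γ i f ≡ countAtLeast (fiberSize f) i
γ-countAtLeast i f = filter-tabulate-count (λ y → i ≤? fiberSize f y) id

fiber-nonempty : ∀ {m n} (f : Fin m → Fin n) {y} → 1 ≤ fiberSize f y → ∃ λ x → f x ≡ y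
fiber-nonempty f {y} 0<size = count-witness (λ x → f x ≟ y) (subst (1 ≤_) (fiberSize-count f y) 0<size)

↑ˡ≢↑ʳ : ∀ {m n} (x : Fin m) (y : Fin n) → x ↑ˡ n ≢ m ↑ʳ y
↑ˡ≢↑ʳ {m} {n} x y eq with trans (sym (splitAt-↑ˡ m x n)) (trans (cong (splitAt m) eq) (splitAt-↑ʳ m n y))
... | ()

⊔-↑ˡ : ∀ {a b c d} (f : Fin a → Fin b) (g : Fin c → Fin d) x → (f ⊔ g) (x ↑ˡ c) ≡ f x ↑ˡ d
⊔-↑ˡ {a} {c = c} f g x rewrite splitAt-↑ˡ a x c = refl

⊔-↑ʳ : ∀ {a b c d} (f : Fin a → Fin b) (g : Fin c → Fin d) x → (f ⊔ g) (a ↑ʳ x) ≡ b ↑ʳ g x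
⊔-↑ʳ {a} {c = c} f g x rewrite splitAt-↑ʳ a c x = refl

fiberSize-⊔-↑ˡ : ∀ {a b c d} (f : Fin a → Fin b) (g : Fin c → Fin d) y →
  fiberSize (f ⊔ g) (y ↑ˡ d) ≡ fiberSize f y
fiberSize-⊔-↑ˡ {a} {b} {c} {d} f g y = begin
  fiberSize (f ⊔ g) (y ↑ˡ d)
    ≡⟨ fiberSize-count (f ⊔ g) _ ⟩
  count (λ x → (f ⊔ g) x ≟ y ↑ˡ d)
    ≡⟨ count-split a c _ ⟩
  count (λ x → (f ⊔ g) (x ↑ˡ c) ≟ y ↑ˡ d) + count (λ x → (f ⊔ g) (a ↑ʳ x) ≟ y ↑ˡ d)
    ≡⟨ cong₂ _+_ (count-cong _ _ (λ x eq → ↑ˡ-injective d _ _ (trans (sym (⊔-↑ˡ f g x)) eq))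
                                 (λ x eq → trans (⊔-↑ˡ f g x) (cong (_↑ˡ d) eq)))
                 (count-none _ (λ x eq → ↑ˡ≢↑ʳ y (g x) (sym (trans (sym (⊔-↑ʳ f g x)) eq)))) ⟩
  count (λ x → f x ≟ y) + 0
    ≡⟨ +-identityʳ _ ⟩
  count (λ x → f x ≟ y)
    ≡⟨ fiberSize-count f y ⟨
  fiberSize f y ∎
  where open ≡-Reasoning

fiberSize-⊔-↑ʳ : ∀ {a b c d} (f : Fin a → Fin b) (g : Fin c → Fin d) y →
  fiberSize (f ⊔ g) (b ↑ʳ y) ≡ fiberSize g y
fiberSize-⊔-↑ʳ {a} {b} {c} {d} f g y = begin
  fiberSize (f ⊔ g) (b ↑ʳ y)
    ≡⟨ fiberSize-count (f ⊔ g) _ ⟩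
  count (λ x → (f ⊔ g) x ≟ b ↑ʳ y)
    ≡⟨ count-split a c _ ⟩
  count (λ x → (f ⊔ g) (x ↑ˡ c) ≟ b ↑ʳ y) + count (λ x → (f ⊔ g) (a ↑ʳ x) ≟ b ↑ʳ y)
    ≡⟨ cong₂ _+_ (count-none _ (λ x eq → ↑ˡ≢↑ʳ (f x) y (trans (sym (⊔-↑ˡ f g x)) eq)))
                 (count-cong _ _ (λ x eq → ↑ʳ-injective b _ _ (trans (sym (⊔-↑ʳ f g x)) eq))
                                 (λ x eq → trans (⊔-↑ʳ f g x) (cong (b ↑ʳ_) eq))) ⟩
  count (λ x → g x ≟ y)
    ≡⟨ fiberSize-count g y ⟨
  fiberSize g y ∎
  where open ≡-Reasoning

fiberSize-idF : ∀ z (y : Fin z) → fiberSize (idF z) y ≡ 1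
fiberSize-idF (suc z) y = begin
  fiberSize (idF (suc z)) y
    ≡⟨ fiberSize-count (idF (suc z)) y ⟩
  count (λ x → x ≟ y)
    ≡⟨ count-punchIn (λ x → x ≟ y) y refl ⟩
  suc (count (λ x → punchIn y x ≟ y))
    ≡⟨ cong suc (count-none _ (punchInᵢ≢i y)) ⟩
  1 ∎
  where open ≡-Reasoning

γ-⊔ : ∀ i {a b c d} (f : Fin a → Fin b) (g : Fin c → Fin d) → γ i (f ⊔ g) ≡ γ i f + γ i g
γ-⊔ i {b = b} {d = d} f g = begin
  γ i (f ⊔ g)
    ≡⟨ γ-countAtLeast i (f ⊔ g) ⟩
  countAtLeast (fiberSize (f ⊔ g)) i
    ≡⟨ count-split b d _ ⟩
  countAtLeast (λ y → fiberSize (f ⊔ g) (y ↑ˡ d)) i + countAtLeast (λ y → fiberSize (f ⊔ g) (b ↑ʳ y)) i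
    ≡⟨ cong₂ _+_ (countAtLeast-cong (fiberSize-⊔-↑ˡ f g) i) (countAtLeast-cong (fiberSize-⊔-↑ʳ f g) i) ⟩
  countAtLeast (fiberSize f) i + countAtLeast (fiberSize g) i
    ≡⟨ cong₂ _+_ (γ-countAtLeast i f) (γ-countAtLeast i g) ⟨
  γ i f + γ i g ∎
  where open ≡-Reasoning

γ-idF : ∀ {i} → 2 ≤ i → ∀ z → γ i (idF z) ≡ 0
γ-idF {i} 2≤i z = trans (γ-countAtLeast i (idF z))
  (count-none _ (λ y i≤size → 2≰1 (≤-trans 2≤i (subst (i ≤_) (fiberSize-idF z y) i≤size))))
  where
  2≰1 : ¬ 2 ≤ 1
  2≰1 (s≤s ())

module _ {p m n q} {h : Fin m → Fin n} {k : Fin p → Fin q} {ξ₁ : Fin p → Fin m} {ξ₂ : Fin n → Fin q}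
         (ξ₁-injective : Injective _≡_ _≡_ ξ₁) (ξ₂-injective : Injective _≡_ _≡_ ξ₂)
         (square : ∀ x → ξ₂ (h (ξ₁ x)) ≡ k x) where

  fiberSize-square : ∀ w → fiberSize k (ξ₂ w) ≤ fiberSize h w
  fiberSize-square w = subst₂ _≤_ (sym (fiberSize-count k (ξ₂ w))) (sym (fiberSize-count h w))
    (matching⇒count≤ (λ x → k x ≟ ξ₂ w) (λ u → h u ≟ w) record
      { partner   = λ x _ → ξ₁ x
      ; related   = λ x kx≡ξ₂w → ξ₂-injective (trans (square x) kx≡ξ₂w)
      ; injective = λ _ _ → ξ₁-injective
      })

  γ-square : ∀ {i} → 1 ≤ i → γ i k ≤ γ i h
  γ-square {i} 1≤i = subst₂ _≤_ (sym (γ-countAtLeast i k)) (sym (γ-countAtLeast i h))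
    (matching⇒count≤ (λ y → i ≤? fiberSize k y) (λ w → i ≤? fiberSize h w) record
      { partner   = image
      ; related   = image-large
      ; injective = λ py py′ eq →
          trans (sym (image-over py)) (trans (cong ξ₂ eq) (image-over py′))
      })
    where
    image : ∀ y → i ≤ fiberSize k y → Fin n
    image y i≤size = h (ξ₁ (proj₁ (fiber-nonempty k (≤-trans 1≤i i≤size))))

    image-over : ∀ {y} (i≤size : i ≤ fiberSize k y) → ξ₂ (image y i≤size) ≡ y
    image-over i≤size = trans (square _) (proj₂ (fiber-nonempty k (≤-trans 1≤i i≤size)))

    image-large : ∀ y (i≤size : i ≤ fiberSize k y) → i ≤ fiberSize h (image y i≤size)
    image-large y i≤size = ≤-trans (subst (λ v → i ≤ fiberSize k v) (sym (image-over i≤size)) i≤size)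
                                   (fiberSize-square (image y i≤size))

≽⇒γ≥ : ∀ {i} → 2 ≤ i → ∀ {m n p q} (f : Fin m → Fin n) (g : Fin p → Fin q) → f ≽ g → γ i f ≥ γ i g
≽⇒γ≥ {i} 2≤i f g (z , _ , _ , j , ξ₁ , ξ₂ , ξ₁-injective , ξ₂-injective , square) = begin
  γ i g                     ≤⟨ m≤m+n (γ i g) (γ i j) ⟩
  γ i g + γ i j             ≡⟨ γ-⊔ i g j ⟨
  γ i (g ⊔ j)               ≤⟨ γ-square ξ₁-injective ξ₂-injective square (≤-trans (s≤s z≤n) 2≤i) ⟩
  γ i (f ⊔ idF z)           ≡⟨ γ-⊔ i f (idF z) ⟩
  γ i f + γ i (idF z)       ≡⟨ cong (γ i f +_) (γ-idF 2≤i z) ⟩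
  γ i f + 0                 ≡⟨ +-identityʳ (γ i f) ⟩
  γ i f                     ∎
  where open ≤-Reasoning

DominatedFrom : ∀ {q n} → ℕ → (Fin q → ℕ) → (Fin n → ℕ) → Set
DominatedFrom t a b = ∀ i → t ≤ i → countAtLeast a i ≤ countAtLeast b i

DominatedFrom-punchIn : ∀ {t q n} {a : Fin (suc q) → ℕ} {b : Fin (suc n) → ℕ} {y w} →
  (∀ y′ → a y′ ≤ a y) → a y ≤ b w → DominatedFrom t a b →
  DominatedFrom t (λ x → a (punchIn y x)) (λ x → b (punchIn w x))
DominatedFrom-punchIn {a = a} {b} {y} {w} a≤a[y] a[y]≤b[w] dom i t≤i with i ≤? a y
... | yes i≤a[y] = ≤-pred (subst₂ _≤_
        (count-punchIn (λ y′ → i ≤? a y′) y i≤a[y])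
        (count-punchIn (λ w′ → i ≤? b w′) w (≤-trans i≤a[y] a[y]≤b[w]))
        (dom i t≤i))
... | no  i≰a[y] = subst (_≤ _)
        (sym (count-none (λ x → i ≤? a (punchIn y x)) (λ x i≤ → i≰a[y] (≤-trans i≤ (a≤a[y] _)))))
        z≤n

-- Greedy matching: the largest value of a is served by an element of b that is at least as large,
-- and removing both preserves domination.
dominance⇒matching : ∀ t {q n} (a : Fin q → ℕ) (b : Fin n → ℕ) → DominatedFrom t a b →
  Matching (λ y → t ≤ a y) (λ y w → a y ≤ b w)
dominance⇒matching t {zero}  a b dom = Matching-∅ (λ ())
dominance⇒matching t {suc q} a b dom = match-ymax (t ≤? a ymax) b dom
  where
  ymax : Fin (suc q)
  ymax = argmax a zero (allFin (suc q))

  a≤a[ymax] : ∀ y → a y ≤ a ymax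
  a≤a[ymax] y = All.lookup (f[xs]≤f[argmax] {f = a} zero (allFin (suc q))) (∈-allFin y)

  match-ymax-with : ∀ {n} (b : Fin n → ℕ) → DominatedFrom t a b → ∃ (λ w → a ymax ≤ b w) →
    Matching (λ y → t ≤ a y) (λ y w → a y ≤ b w)
  match-ymax-with {suc n} b dom (w , a[ymax]≤b[w]) = Matching-punchIn ymax w a[ymax]≤b[w]
    (dominance⇒matching t (λ x → a (punchIn ymax x)) (λ x → b (punchIn w x))
       (DominatedFrom-punchIn a≤a[ymax] a[ymax]≤b[w] dom))

  match-ymax : Dec (t ≤ a ymax) → ∀ {n} (b : Fin n → ℕ) → DominatedFrom t a b →
    Matching (λ y → t ≤ a y) (λ y w → a y ≤ b w)
  match-ymax (no t≰a[ymax]) b dom =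
    Matching-∅ (λ y t≤a[y] → t≰a[ymax] (≤-trans t≤a[y] (a≤a[ymax] y)))
  match-ymax (yes t≤a[ymax]) b dom = match-ymax-with b dom
    (count-witness (λ w → a ymax ≤? b w) (≤-trans 0<countAtLeast (dom (a ymax) t≤a[ymax])))
    where
    0<countAtLeast : 1 ≤ countAtLeast a (a ymax)
    0<countAtLeast = subst (1 ≤_) (sym (count-punchIn (λ y → a ymax ≤? a y) ymax ≤-refl)) (s≤s z≤n)

fiberwise-embedding : ∀ {m n p q} (h : Fin m → Fin n) (g : Fin p → Fin q) (τ : Fin q → Fin n) →
  Injective _≡_ _≡_ τ → (∀ y → fiberSize g y ≤ fiberSize h (τ y)) →
  Σ (Fin p → Fin m) λ ξ → Injective _≡_ _≡_ ξ × (∀ x → h (ξ x) ≡ τ (g x))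
fiberwise-embedding {m} {p = p} h g τ τ-injective fibers≤ = ξ , ξ-injective , λ x → related (Φ (g x)) x refl
  where
  Φ : ∀ y → Matching (λ x → g x ≡ y) (λ _ u → h u ≡ τ y)
  Φ y = count≤⇒matching (λ x → g x ≟ y) (λ u → h u ≟ τ y)
    (subst₂ _≤_ (fiberSize-count g y) (fiberSize-count h (τ y)) (fibers≤ y))

  ξ : Fin p → Fin m
  ξ x = partner (Φ (g x)) x refl

  ξ-via : ∀ {x y} (gx≡y : g x ≡ y) → ξ x ≡ partner (Φ y) x gx≡y
  ξ-via refl = refl

  ξ-injective : Injective _≡_ _≡_ ξ
  ξ-injective {x} {x′} eq = injective (Φ (g x)) refl gx′≡gx (trans eq (ξ-via gx′≡gx))
    where
    gx′≡gx : g x′ ≡ g x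
    gx′≡gx = τ-injective (trans (sym (related (Φ (g x′)) x′ refl))
                               (trans (cong h (sym eq)) (related (Φ (g x)) x refl)))

injective-leftInverse : ∀ {q a} (τ : Fin q → Fin a) → Injective _≡_ _≡_ τ →
  Σ (Fin a → Fin (q + a)) λ ρ → Injective _≡_ _≡_ ρ × (∀ y → ρ (τ y) ≡ y ↑ˡ a)
injective-leftInverse {q} {a} τ τ-injective =
  ρ , (λ {u} {u′} → ρ′-injective u u′ (τ⁻¹? u) (τ⁻¹? u′)) , ρ-τ
  where
  τ⁻¹? : ∀ u → Dec (∃ λ y → τ y ≡ u)
  τ⁻¹? u = any? (λ y → τ y ≟ u)

  ρ′ : ∀ u → Dec (∃ λ y → τ y ≡ u) → Fin (q + a)
  ρ′ u (yes (y , _)) = y ↑ˡ a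
  ρ′ u (no _)        = q ↑ʳ u

  ρ : Fin a → Fin (q + a)
  ρ u = ρ′ u (τ⁻¹? u)

  ρ-τ : ∀ y → ρ (τ y) ≡ y ↑ˡ a
  ρ-τ y with τ⁻¹? (τ y)
  ... | yes (y′ , τy′≡τy) = cong (_↑ˡ a) (τ-injective τy′≡τy)
  ... | no  ∄y            = ⊥-elim (∄y (y , refl))

  ρ′-injective : ∀ u u′ d d′ → ρ′ u d ≡ ρ′ u′ d′ → u ≡ u′
  ρ′-injective u u′ (yes (y , τy≡u)) (yes (y′ , τy′≡u′)) eq =
    trans (sym τy≡u) (trans (cong τ (↑ˡ-injective a y y′ eq)) τy′≡u′)
  ρ′-injective u u′ (yes _) (no _)  eq = ⊥-elim (↑ˡ≢↑ʳ _ _ eq)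
  ρ′-injective u u′ (no _)  (yes _) eq = ⊥-elim (↑ˡ≢↑ʳ _ _ (sym eq))
  ρ′-injective u u′ (no _)  (no _)  eq = ↑ʳ-injective q u u′ eq

square⇒≽ : ∀ {m n p q} (f : Fin m → Fin n) (g : Fin p → Fin q) z
  (ξ : Fin p → Fin (m + z)) (τ : Fin q → Fin (n + z)) →
  Injective _≡_ _≡_ ξ → Injective _≡_ _≡_ τ → (∀ x → (f ⊔ idF z) (ξ x) ≡ τ (g x)) → f ≽ g
square⇒≽ {n = n} {p} {q} f g z ξ τ ξ-injective τ-injective square =
  from-leftInverse (injective-leftInverse τ τ-injective)
  where
  -- With r = 0 the map j is empty, so g ⊔ j is g up to the padding Fin (p + 0).
  j : Fin 0 → Fin (n + z)
  j ()

  unpad : Fin (p + 0) → Fin p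
  unpad x = [ id , (λ ()) ]′ (splitAt p x)

  unpad-↑ˡ : ∀ x → unpad x ↑ˡ 0 ≡ x
  unpad-↑ˡ x with splitAt p x in eq
  ... | inj₁ x′ = splitAt⁻¹-↑ˡ eq

  unpad-injective : Injective _≡_ _≡_ unpad
  unpad-injective {x} {x′} eq = trans (sym (unpad-↑ˡ x)) (trans (cong (_↑ˡ 0) eq) (unpad-↑ˡ x′))

  g⊔j-unpad : ∀ x → (g ⊔ j) x ≡ g (unpad x) ↑ˡ (n + z)
  g⊔j-unpad x with splitAt p x
  ... | inj₁ x′ = refl

  from-leftInverse : (Σ (Fin (n + z) → Fin (q + (n + z))) λ ρ →
                       Injective _≡_ _≡_ ρ × (∀ y → ρ (τ y) ≡ y ↑ˡ (n + z))) → f ≽ g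
  from-leftInverse (ρ , ρ-injective , ρ-τ) =
    z , 0 , n + z , j , ξ ∘ unpad , ρ , unpad-injective ∘ ξ-injective , ρ-injective , commutes
    where
    commutes : ∀ x → ρ ((f ⊔ idF z) (ξ (unpad x))) ≡ (g ⊔ j) x
    commutes x = begin
      ρ ((f ⊔ idF z) (ξ (unpad x)))  ≡⟨ cong ρ (square (unpad x)) ⟩
      ρ (τ (g (unpad x)))            ≡⟨ ρ-τ (g (unpad x)) ⟩
      g (unpad x) ↑ˡ (n + z)         ≡⟨ g⊔j-unpad x ⟨
      (g ⊔ j) x                      ∎
      where open ≡-Reasoning

γ≥⇒≽ : ∀ {m n p q} (f : Fin m → Fin n) (g : Fin p → Fin q) → (∀ i → 2 ≤ i → γ i f ≥ γ i g) → f ≽ g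
γ≥⇒≽ {m} {n} {p} {q} f g γf≥γg = from-embedding
  (fiberwise-embedding (f ⊔ idF q) g τ τ-injective (λ y → fiberSize-τ′ y (2 ≤? fiberSize g y)))
  where
  σ : Matching (λ y → 2 ≤ fiberSize g y) (λ y w → fiberSize g y ≤ fiberSize f w)
  σ = dominance⇒matching 2 (fiberSize g) (fiberSize f)
    (λ i 2≤i → subst₂ _≤_ (γ-countAtLeast i g) (γ-countAtLeast i f) (γf≥γg i 2≤i))

  -- Z is a copy of the codomain of g: a large fiber of g lies over its σ-partner in f,
  -- a singleton fiber over the copy of its point in 1_Z.
  τ′ : ∀ y → Dec (2 ≤ fiberSize g y) → Fin (n + q)
  τ′ y (yes large) = partner σ y large ↑ˡ q
  τ′ y (no _)      = n ↑ʳ y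

  τ : Fin q → Fin (n + q)
  τ y = τ′ y (2 ≤? fiberSize g y)

  τ′-injective : ∀ y y′ d d′ → τ′ y d ≡ τ′ y′ d′ → y ≡ y′
  τ′-injective y y′ (yes large) (yes large′) eq = injective σ large large′ (↑ˡ-injective q _ _ eq)
  τ′-injective y y′ (yes _)     (no _)       eq = ⊥-elim (↑ˡ≢↑ʳ _ _ eq)
  τ′-injective y y′ (no _)      (yes _)      eq = ⊥-elim (↑ˡ≢↑ʳ _ _ (sym eq))
  τ′-injective y y′ (no _)      (no _)       eq = ↑ʳ-injective n y y′ eq

  τ-injective : Injective _≡_ _≡_ τ
  τ-injective {y} {y′} = τ′-injective y y′ (2 ≤? fiberSize g y) (2 ≤? fiberSize g y′)

  fiberSize-τ′ : ∀ y d → fiberSize g y ≤ fiberSize (f ⊔ idF q) (τ′ y d)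
  fiberSize-τ′ y (yes large) =
    subst (fiberSize g y ≤_) (sym (fiberSize-⊔-↑ˡ f (idF q) _)) (related σ y large)
  fiberSize-τ′ y (no small) =
    subst (fiberSize g y ≤_) (sym (trans (fiberSize-⊔-↑ʳ f (idF q) y) (fiberSize-idF q y))) (≤-pred (≰⇒> small))

  from-embedding : (Σ (Fin p → Fin (m + q)) λ ξ →
                     Injective _≡_ _≡_ ξ × (∀ x → (f ⊔ idF q) (ξ x) ≡ τ (g x))) → f ≽ g
  from-embedding (ξ , ξ-injective , square) = square⇒≽ f g q ξ τ ξ-injective τ-injective square

proposition4p3 :
    ((i : ℕ) → 2 ≤ i →
      (∀ {m n p q} (f : Fin m → Fin n) (g : Fin p → Fin q) → f ≽ g → γ i f ≥ γ i g)
      × (∀ {m n p q} (f : Fin m → Fin n) (g : Fin p → Fin q) → γ i (f ⊔ g) ≡ γ i f + γ i g)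
      × (∀ z → γ i (idF z) ≡ 0))
    × (∀ {m n p q} (f : Fin m → Fin n) (g : Fin p → Fin q) →
        (f ≽ g) ⇔ (∀ i → 2 ≤ i → γ i f ≥ γ i g))
proposition4p3 =
  (λ i 2≤i → ≽⇒γ≥ 2≤i , γ-⊔ i , γ-idF 2≤i) ,
  (λ f g → mk⇔ (λ f≽g i 2≤i → ≽⇒γ≥ 2≤i f g f≽g) (γ≥⇒≽ f g))
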